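{- Let $G$ be a bridgeless graph with $m$ edges having vertices $v_1$ and $v_2$ joined by $k\ge 3$ parallel edges. Suppose that the degree of $v_1$ is $k$, the degree of $v_2$ is at least $k+3$, and the graph $G'=G\setminus v_1$ (obtained by deleting $v_1$) has a cycle cover with three cycles of total length at most $44(m-k)/27$. Then $G$ has a cycle cover with three cycles of total length at most $44m/27$.
   Context: Graphs may have loops and parallel edges. A cycle is a subgraph with all degrees even (possibly empty). A cycle cover is a collection of cycles such that every edge lies in at least one of them; its (total) length is the sum of the numbers of edges of its cycles. A graph is bridgeless if it has no edge-cut of size one. -}

module Defs where

open import Data.Nat using (ℕ; zero; suc; _+_; _*_; _≤_)
open import Data.Nat.Divisibility using (_∣_)
open import Data.Bool using (Bool; true; false; if_then_else_; _∨_; _xor_)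
open import Data.Fin using (Fin; _≟_; punchOut)
open import Data.Product using (_×_; _,_; Σ)
open import Data.List using (List; []; _∷_; length; lookup; map; allFin)
open import Data.Nat.ListAction using (sum)
open import Relation.Nullary using (¬_; yes; no)
open import Relation.Nullary.Decidable using (⌊_⌋)
open import Relation.Binary.PropositionalEquality using (_≡_)

-- A finite multigraph on the vertex set Fin n: a list of edges, each given
-- by its (unordered) pair of ends.  Loops (a , a) and parallel edges
-- (repeated entries) are allowed.
Graph : ℕ → Set
Graph n = List (Fin n × Fin n)

Edge : ∀ {n} → Graph n → Set
Edge G = Fin (length G)

ends : ∀ {n} (G : Graph n) → Edge G → Fin n × Fin n
ends G e = lookup G e

numEdges : ∀ {n} → Graph n → ℕ
numEdges G = length G

EdgeSet : ∀ {n} → Graph n → Set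
EdgeSet G = Edge G → Bool

allEdges : ∀ {n} (G : Graph n) → EdgeSet G
allEdges G _ = true

-- number of ends of the edge (a , b) at v (a loop at v counts twice)
incidence : ∀ {n} → Fin n → Fin n × Fin n → ℕ
incidence v (a , b) = (if ⌊ a ≟ v ⌋ then 1 else 0) + (if ⌊ b ≟ v ⌋ then 1 else 0)

sumE : ∀ {n} (G : Graph n) → (Edge G → ℕ) → ℕ
sumE G f = sum (map f (allFin (length G)))

degIn : ∀ {n} (G : Graph n) → EdgeSet G → Fin n → ℕ
degIn G S v = sumE G (λ e → if S e then incidence v (ends G e) else 0)

deg : ∀ {n} → Graph n → Fin n → ℕ
deg G v = degIn G (allEdges G) v

size : ∀ {n} (G : Graph n) → EdgeSet G → ℕ
size G S = sumE G (λ e → if S e then 1 else 0)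

joins : ∀ {n} → Fin n → Fin n → Fin n × Fin n → Bool
joins u v (a , b) = (⌊ a ≟ u ⌋ Data.Bool.∧ ⌊ b ≟ v ⌋) ∨ (⌊ a ≟ v ⌋ Data.Bool.∧ ⌊ b ≟ u ⌋)

multiplicity : ∀ {n} (G : Graph n) → Fin n → Fin n → ℕ
multiplicity G u v = sumE G (λ e → if joins u v (ends G e) then 1 else 0)

-- a cycle: a (possibly empty) subgraph in which every degree is even
IsCycle : ∀ {n} (G : Graph n) → EdgeSet G → Set
IsCycle G S = ∀ v → 2 ∣ degIn G S v

cutSize : ∀ {n} (G : Graph n) → (Fin n → Bool) → ℕ
cutSize G X = sumE G (λ e → cross (ends G e))
  where
  cross : _ → ℕ
  cross (a , b) = if X a xor X b then 1 else 0

Bridgeless : ∀ {n} → Graph n → Set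
Bridgeless {n} G = ∀ (X : Fin n → Bool) → ¬ (cutSize G X ≡ 1)

record ThreeCycleCover {n} (G : Graph n) : Set where
  field
    C₁ C₂ C₃ : EdgeSet G
    cyc₁ : IsCycle G C₁
    cyc₂ : IsCycle G C₂
    cyc₃ : IsCycle G C₃
    covers : ∀ e → (C₁ e ∨ C₂ e ∨ C₃ e) ≡ true

coverLength : ∀ {n} {G : Graph n} → ThreeCycleCover G → ℕ
coverLength {G = G} C = size G C₁ + size G C₂ + size G C₃
  where open ThreeCycleCover C

deleteVertex : ∀ {n} → Graph (suc n) → Fin (suc n) → Graph n
deleteVertex [] v = []
deleteVertex ((a , b) ∷ G) v with v ≟ a | v ≟ b
... | yes _ | _ = deleteVertex G v
... | no _ | yes _ = deleteVertex G v
... | no v≢a | no v≢b = (punchOut v≢a , punchOut v≢b) ∷ deleteVertex G v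

module Submission where

-- Since v₁ has degree k and is joined to v₂ by k
-- parallel edges, every edge at v₁ is one of these k edges (a loop at v₁
-- would contribute 2 to the degree but only 1 to the multiplicity).  So G
-- is G' = G \ v₁ plus a bundle of k parallel v₁v₂-edges.  Each cycle of G'
-- extends to a cycle of G by adding any EVEN number of bundle edges: the
-- degree of every vertex changes by an even amount.  It therefore suffices
-- to cover a bundle of k ≥ 2 edges by three even sets of total size at most
-- k + 1 (all edges if k is even; k - 1 and 2 overlapping edges if k is
-- odd); as 27(k + 1) ≤ 44k for k ≥ 2 the length bound follows.

open import Defs
open import Data.Nat using (ℕ; zero; suc; _+_; _*_; _∸_; _≤_; _<_; z≤n; s≤s)
open import Data.Nat.Properties hiding (_≟_)
open import Data.Nat.Divisibility using (_∣_; ∣-refl; _∣0; ∣m⇒∣m*n; ∣m∣n⇒∣m+n)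
open import Data.Nat.Tactic.RingSolver using (solve-∀)
open import Data.Bool using (Bool; true; false; if_then_else_; _∨_; _∧_)
open import Data.Bool.Properties using (∧-zeroʳ)
open import Data.Fin using (Fin; _≟_; punchOut) renaming (zero to fz; suc to fs)
open import Data.Fin.Properties using (punchOut-cong; punchOut-injective)
open import Data.Product using (Σ; _×_; _,_; proj₁; proj₂)
open import Data.List using ([]; _∷_; length)
open import Data.List.Properties using (map-tabulate)
open import Data.Nat.ListAction using (sum)
open import Data.Unit using (⊤; tt)
open import Data.Empty using (⊥-elim)
open import Data.Vec.Functional using () renaming (_∷_ to _∷ᵛ_)
open import Function using (_∘_; id)
open import Relation.Nullary using (yes; no)
open import Relation.Nullary.Decidable using (⌊_⌋)
open import Relation.Binary.PropositionalEquality
  using (_≡_; _≢_; refl; sym; trans; cong; cong₂; subst; module ≡-Reasoning)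

≟-yes : ∀ {m} {x y : Fin m} → x ≡ y → ⌊ x ≟ y ⌋ ≡ true
≟-yes {x = x} {y} x≡y with x ≟ y
... | yes _ = refl
... | no x≢y = ⊥-elim (x≢y x≡y)

≟-no : ∀ {m} {x y : Fin m} → x ≢ y → ⌊ x ≟ y ⌋ ≡ false
≟-no {x = x} {y} x≢y with x ≟ y
... | yes x≡y = ⊥-elim (x≢y x≡y)
... | no _ = refl

≟-true : ∀ {m} {x y : Fin m} → ⌊ x ≟ y ⌋ ≡ true → x ≡ y
≟-true {x = x} {y} _ with x ≟ y
≟-true _  | yes x≡y = x≡y
≟-true () | no _

ind : Bool → ℕ
ind b = if b then 1 else 0

ind≤1 : ∀ b → ind b ≤ 1
ind≤1 true = s≤s z≤n
ind≤1 false = z≤n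

sumE-cons : ∀ {n} x (G : Graph n) (f : Edge (x ∷ G) → ℕ) →
  sumE (x ∷ G) f ≡ f fz + sumE G (f ∘ fs)
sumE-cons x G f = cong (λ l → f fz + sum l)
  (trans (map-tabulate fs f) (sym (map-tabulate id (f ∘ fs))))

degIn-cons : ∀ {n} x (G : Graph n) (S : EdgeSet (x ∷ G)) v →
  degIn (x ∷ G) S v ≡ (if S fz then incidence v x else 0) + degIn G (S ∘ fs) v
degIn-cons x G S v = sumE-cons x G _

size-cons : ∀ {n} x (G : Graph n) (S : EdgeSet (x ∷ G)) →
  size (x ∷ G) S ≡ ind (S fz) + size G (S ∘ fs)
size-cons x G S = sumE-cons x G _

multiplicity-cons : ∀ {n} x (G : Graph n) u v →
  multiplicity (x ∷ G) u v ≡ ind (joins u v x) + multiplicity G u v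
multiplicity-cons x G u v = sumE-cons x G _

deg-cons : ∀ {n} x (G : Graph n) v → deg (x ∷ G) v ≡ incidence v x + deg G v
deg-cons x G v = degIn-cons x G (allEdges (x ∷ G)) v

incidence-swap : ∀ {n} (v a b : Fin n) → incidence v (a , b) ≡ incidence v (b , a)
incidence-swap v a b = +-comm (ind ⌊ a ≟ v ⌋) (ind ⌊ b ≟ v ⌋)

incidence-avoid : ∀ {n} {v a b : Fin n} → a ≢ v → b ≢ v → incidence v (a , b) ≡ 0
incidence-avoid a≢v b≢v rewrite ≟-no a≢v | ≟-no b≢v = refl

punchOut-≟ : ∀ {n} {i v a : Fin (suc n)} (i≢v : i ≢ v) (i≢a : i ≢ a) →
  ⌊ punchOut i≢a ≟ punchOut i≢v ⌋ ≡ ⌊ a ≟ v ⌋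
punchOut-≟ {i = i} {v} {a} i≢v i≢a with a ≟ v
... | yes a≡v = ≟-yes (punchOut-cong i a≡v)
... | no a≢v = ≟-no (a≢v ∘ punchOut-injective i≢a i≢v)

incidence-punchOut : ∀ {n} {i v a b : Fin (suc n)} (i≢v : i ≢ v) (i≢a : i ≢ a) (i≢b : i ≢ b) →
  incidence (punchOut i≢v) (punchOut i≢a , punchOut i≢b) ≡ incidence v (a , b)
incidence-punchOut i≢v i≢a i≢b rewrite punchOut-≟ i≢v i≢a | punchOut-≟ i≢v i≢b = refl

-- Bundles.  A bundle of r parallel edges is indexed by 0 … r-1; a subset
-- of it is given by a pattern P : ℕ → Bool, of which only P 0 … P (r-1)
-- matter.  count r P is the number of chosen edges.

Pattern : Set
Pattern = ℕ → Bool

count : ℕ → Pattern → ℕ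
count zero P = 0
count (suc r) P = ind (P 0) + count r (P ∘ suc)

none : Pattern
none _ = false

_◂_ : Bool → Pattern → Pattern
(b ◂ P) zero = b
(b ◂ P) (suc j) = P j

infixr 5 _◂_

-- Three even subsets of a bundle of r edges covering it, with total size at
-- most r + 1.  Adding an even subset of a bundle to a cycle keeps it a cycle.
record BundleCover (r : ℕ) : Set where
  field
    P₁ P₂ P₃ : Pattern
    even₁ : 2 ∣ count r P₁
    even₂ : 2 ∣ count r P₂
    even₃ : 2 ∣ count r P₃
    covers : ∀ j → j < r → (P₁ j ∨ P₂ j ∨ P₃ j) ≡ true
    total≤ : count r P₁ + count r P₂ + count r P₃ ≤ suc r

bundleCover₂ : BundleCover 2
bundleCover₂ = record
  { P₁ = true ◂ true ◂ none ; P₂ = none ; P₃ = none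
  ; even₁ = ∣-refl ; even₂ = 2 ∣0 ; even₃ = 2 ∣0 ; covers = covers ; total≤ = s≤s (s≤s z≤n) }
  where
  covers : ∀ j → j < 2 → ((true ◂ true ◂ none) j ∨ false ∨ false) ≡ true
  covers 0 _ = refl
  covers 1 _ = refl
  covers (suc (suc j)) (s≤s (s≤s ()))

bundleCover₃ : BundleCover 3
bundleCover₃ = record
  { P₁ = false ◂ true ◂ true ◂ none ; P₂ = true ◂ true ◂ none ; P₃ = none
  ; even₁ = ∣-refl ; even₂ = ∣-refl ; even₃ = 2 ∣0 ; covers = covers ; total≤ = ≤-refl }
  where
  covers : ∀ j → j < 3 → ((false ◂ true ◂ true ◂ none) j ∨ (true ◂ true ◂ none) j ∨ false) ≡ true
  covers 0 _ = refl
  covers 1 _ = refl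
  covers 2 _ = refl
  covers (suc (suc (suc j))) (s≤s (s≤s (s≤s ())))

bundleCover-step : ∀ {r} → BundleCover r → BundleCover (2 + r)
bundleCover-step {r} B = record
  { P₁ = true ◂ true ◂ P₁ ; P₂ = false ◂ false ◂ P₂ ; P₃ = false ◂ false ◂ P₃
  ; even₁ = ∣m∣n⇒∣m+n ∣-refl even₁ ; even₂ = even₂ ; even₃ = even₃
  ; covers = covers′ ; total≤ = s≤s (s≤s total≤) }
  where
  open BundleCover B
  covers′ : ∀ j → j < 2 + r →
    ((true ◂ true ◂ P₁) j ∨ (false ◂ false ◂ P₂) j ∨ (false ◂ false ◂ P₃) j) ≡ true
  covers′ 0 _ = refl
  covers′ 1 _ = refl
  covers′ (suc (suc j)) (s≤s (s≤s j<r)) = covers j j<r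

bundleLength : ∀ {r} → BundleCover r → ℕ
bundleLength {r} B = count r P₁ + count r P₂ + count r P₃
  where open BundleCover B

bundleCover : ∀ r → 2 ≤ r → BundleCover r
bundleCover 1 (s≤s ())
bundleCover 2 _ = bundleCover₂
bundleCover 3 _ = bundleCover₃
bundleCover (suc (suc (suc (suc r)))) _ = bundleCover-step (bundleCover (suc (suc r)) (s≤s (s≤s z≤n)))

+-tight : ∀ x y x′ y′ → x + y ≡ x′ + y′ → x′ ≤ x → y′ ≤ y → x ≡ x′ × y ≡ y′
+-tight x y x′ y′ eq x′≤x y′≤y = x≡x′ , +-cancelˡ-≡ x y y′ (trans eq (cong (_+ y′) (sym x≡x′)))
  where
  x+y′≤x′+y′ : x + y′ ≤ x′ + y′
  x+y′≤x′+y′ = subst (x + y′ ≤_) eq (+-monoʳ-≤ x y′≤y)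
  x≡x′ : x ≡ x′
  x≡x′ = ≤-antisym (+-cancelʳ-≤ y′ x x′ x+y′≤x′+y′) x′≤x

-- Boolean shadow of a single edge (a , b) seen from v₁, v₂, with
-- p = [a = v₁], q = [b = v₁], r = [a = v₂], s = [b = v₂]: the edge joins
-- v₁ and v₂ iff (p ∧ s) ∨ (r ∧ q), and its incidence with v₁ is p + q.
joins≤incidence : ∀ p q r s → ind ((p ∧ s) ∨ (r ∧ q)) ≤ ind p + ind q
joins≤incidence true q r s = ≤-trans (ind≤1 _) (s≤s z≤n)
joins≤incidence false true r s = ind≤1 _
joins≤incidence false false r s rewrite ∧-zeroʳ r = z≤n

joins≡incidence-first : ∀ p q r s → p ≡ true → r ≡ false →
  ind p + ind q ≡ ind ((p ∧ s) ∨ (r ∧ q)) → s ≡ true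
joins≡incidence-first true q false true _ _ _ = refl
joins≡incidence-first true q false false _ _ ()

joins≡incidence-second : ∀ p q r s → p ≡ false → q ≡ true →
  ind p + ind q ≡ ind ((p ∧ s) ∨ (r ∧ q)) → r ≡ true
joins≡incidence-second false true true s _ _ _ = refl
joins≡incidence-second false true false s _ _ ()

+-interchange₃ : ∀ s₁ s₂ s₃ c₁ c₂ c₃ →
  (s₁ + c₁) + (s₂ + c₂) + (s₃ + c₃) ≡ (s₁ + s₂ + s₃) + (c₁ + c₂ + c₃)
+-interchange₃ = solve-∀

bundle-bound : ∀ k t → 2 ≤ k → t ≤ suc k → 27 * t ≤ 44 * k
bundle-bound 1 t (s≤s ()) _
bundle-bound (suc (suc r)) t _ t≤k+1 = begin
  27 * t                        ≤⟨ *-monoʳ-≤ 27 t≤k+1 ⟩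
  27 * (3 + r)                  ≤⟨ m≤m+n (27 * (3 + r)) (7 + 17 * r) ⟩
  27 * (3 + r) + (7 + 17 * r)   ≡⟨ identity r ⟩
  44 * (2 + r)                  ∎
  where
  open ≤-Reasoning
  identity : ∀ r → 27 * (3 + r) + (7 + 17 * r) ≡ 44 * (2 + r)
  identity = solve-∀

combine-bounds : ∀ L t m k → 27 * L ≤ 44 * (m ∸ k) → 27 * t ≤ 44 * k → k ≤ m →
  27 * (L + t) ≤ 44 * m
combine-bounds L t m k bound-L bound-t k≤m = begin
  27 * (L + t)             ≡⟨ *-distribˡ-+ 27 L t ⟩
  27 * L + 27 * t          ≤⟨ +-mono-≤ bound-L bound-t ⟩
  44 * (m ∸ k) + 44 * k    ≡⟨ sym (*-distribˡ-+ 44 (m ∸ k) k) ⟩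
  44 * (m ∸ k + k)         ≡⟨ cong (44 *_) (m∸n+n≡m k≤m) ⟩
  44 * m                   ∎
  where open ≤-Reasoning

+-swap-front : ∀ i s y → i + (s + y) ≡ s + (i + y)
+-swap-front = solve-∀

add-bundle-edge : ∀ b c d x → (if b then c else 0) + (d + x * c) ≡ d + (ind b + x) * c
add-bundle-edge true c d x = identity c d x
  where
  identity : ∀ c d x → c + (d + x * c) ≡ d + (1 + x) * c
  identity = solve-∀
add-bundle-edge false c d x = refl

-- The edges
-- of G at v₁ (the ones deleteVertex drops) are numbered 0, 1, … in list
-- order; a pattern P decides which of them are added.

module BundleExtension {n : ℕ} (v₁ v₂ : Fin (suc n)) where

  removed : Graph (suc n) → ℕ
  removed [] = 0
  removed ((a , b) ∷ G) with v₁ ≟ a | v₁ ≟ b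
  ... | yes _ | _ = suc (removed G)
  ... | no _ | yes _ = suc (removed G)
  ... | no _ | no _ = removed G

  BundleAt : Graph (suc n) → Set
  BundleAt [] = ⊤
  BundleAt ((a , b) ∷ G) with v₁ ≟ a | v₁ ≟ b
  ... | yes _ | _ = b ≡ v₂ × BundleAt G
  ... | no _ | yes _ = a ≡ v₂ × BundleAt G
  ... | no _ | no _ = BundleAt G

  extend : (G : Graph (suc n)) → EdgeSet (deleteVertex G v₁) → Pattern → EdgeSet G
  extend [] S P ()
  extend ((a , b) ∷ G) S P with v₁ ≟ a | v₁ ≟ b
  ... | yes _ | _ = P 0 ∷ᵛ extend G S (P ∘ suc)
  ... | no _ | yes _ = P 0 ∷ᵛ extend G S (P ∘ suc)
  ... | no _ | no _ = S fz ∷ᵛ extend G (S ∘ fs) P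

  length-removed : ∀ G → length G ≡ length (deleteVertex G v₁) + removed G
  length-removed [] = refl
  length-removed ((a , b) ∷ G) with v₁ ≟ a | v₁ ≟ b
  ... | yes _ | _ = trans (cong suc (length-removed G)) (sym (+-suc _ _))
  ... | no _ | yes _ = trans (cong suc (length-removed G)) (sym (+-suc _ _))
  ... | no _ | no _ = cong suc (length-removed G)

  size-extend : ∀ G S P → size G (extend G S P) ≡ size (deleteVertex G v₁) S + count (removed G) P
  size-extend [] S P = refl
  size-extend ((a , b) ∷ G) S P with v₁ ≟ a | v₁ ≟ b
  ... | yes _ | _ = trans (size-cons (a , b) G _)
        (trans (cong (ind (P 0) +_) (size-extend G S (P ∘ suc))) (+-swap-front (ind (P 0)) (size (deleteVertex G v₁) S) (count (removed G) (P ∘ suc))))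
  ... | no _ | yes _ = trans (size-cons (a , b) G _)
        (trans (cong (ind (P 0) +_) (size-extend G S (P ∘ suc))) (+-swap-front (ind (P 0)) (size (deleteVertex G v₁) S) (count (removed G) (P ∘ suc))))
  ... | no v₁≢a | no v₁≢b = trans (size-cons (a , b) G _)
        (trans (cong (ind (S fz) +_) (size-extend G (S ∘ fs) P))
        (trans (sym (+-assoc (ind (S fz)) _ _))
        (cong (_+ count (removed G) P) (sym (size-cons (punchOut v₁≢a , punchOut v₁≢b) (deleteVertex G v₁) S)))))

  extend-covers : ∀ G (S₁ S₂ S₃ : EdgeSet (deleteVertex G v₁)) P₁ P₂ P₃ →
    (∀ e → (S₁ e ∨ S₂ e ∨ S₃ e) ≡ true) →
    (∀ j → j < removed G → (P₁ j ∨ P₂ j ∨ P₃ j) ≡ true) →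
    ∀ e → (extend G S₁ P₁ e ∨ extend G S₂ P₂ e ∨ extend G S₃ P₃ e) ≡ true
  extend-covers ((a , b) ∷ G) S₁ S₂ S₃ P₁ P₂ P₃ coverS coverP e with v₁ ≟ a | v₁ ≟ b | e
  ... | yes _ | _ | fz = coverP 0 (s≤s z≤n)
  ... | yes _ | _ | fs e′ = extend-covers G S₁ S₂ S₃ (P₁ ∘ suc) (P₂ ∘ suc) (P₃ ∘ suc) coverS
        (λ j j<r → coverP (suc j) (s≤s j<r)) e′
  ... | no _ | yes _ | fz = coverP 0 (s≤s z≤n)
  ... | no _ | yes _ | fs e′ = extend-covers G S₁ S₂ S₃ (P₁ ∘ suc) (P₂ ∘ suc) (P₃ ∘ suc) coverS
        (λ j j<r → coverP (suc j) (s≤s j<r)) e′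
  ... | no _ | no _ | fz = coverS fz
  ... | no _ | no _ | fs e′ = extend-covers G (S₁ ∘ fs) (S₂ ∘ fs) (S₃ ∘ fs) P₁ P₂ P₃ (coverS ∘ fs) coverP e′

  degree-at-v₁ : ∀ G S P → BundleAt G →
    degIn G (extend G S P) v₁ ≡ count (removed G) P * incidence v₁ (v₁ , v₂)
  degree-at-v₁ [] S P _ = refl
  degree-at-v₁ ((a , b) ∷ G) S P bundle with v₁ ≟ a | v₁ ≟ b
  degree-at-v₁ ((a , b) ∷ G) S P (refl , bundle) | yes refl | _ =
    trans (degIn-cons (a , b) G _ v₁)
      (trans (cong (_ +_) (degree-at-v₁ G S (P ∘ suc) bundle))
        (add-bundle-edge (P 0) _ 0 (count (removed G) (P ∘ suc))))
  degree-at-v₁ ((a , b) ∷ G) S P (refl , bundle) | no _ | yes refl =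
    trans (degIn-cons (a , b) G _ v₁)
      (trans (cong₂ _+_ (cong (λ c → if P 0 then c else 0) (incidence-swap v₁ v₂ v₁))
                        (degree-at-v₁ G S (P ∘ suc) bundle))
        (add-bundle-edge (P 0) _ 0 (count (removed G) (P ∘ suc))))
  degree-at-v₁ ((a , b) ∷ G) S P bundle | no v₁≢a | no v₁≢b =
    trans (degIn-cons (a , b) G _ v₁)
      (cong₂ _+_ (kept-edge (S fz)) (degree-at-v₁ G (S ∘ fs) P bundle))
    where
    kept-edge : ∀ s → (if s then incidence v₁ (a , b) else 0) ≡ 0
    kept-edge true = incidence-avoid (v₁≢a ∘ sym) (v₁≢b ∘ sym)
    kept-edge false = refl

  degree-away : ∀ G S P → BundleAt G → ∀ v (v₁≢v : v₁ ≢ v) →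
    degIn G (extend G S P) v ≡
      degIn (deleteVertex G v₁) S (punchOut v₁≢v) + count (removed G) P * incidence v (v₁ , v₂)
  degree-away [] S P _ v v₁≢v = refl
  degree-away ((a , b) ∷ G) S P bundle v v₁≢v with v₁ ≟ a | v₁ ≟ b
  degree-away ((a , b) ∷ G) S P (refl , bundle) v v₁≢v | yes refl | _ =
    trans (degIn-cons (a , b) G _ v)
      (trans (cong (_ +_) (degree-away G S (P ∘ suc) bundle v v₁≢v))
        (add-bundle-edge (P 0) _ _ (count (removed G) (P ∘ suc))))
  degree-away ((a , b) ∷ G) S P (refl , bundle) v v₁≢v | no _ | yes refl =
    trans (degIn-cons (a , b) G _ v)
      (trans (cong₂ _+_ (cong (λ c → if P 0 then c else 0) (incidence-swap v v₂ v₁))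
                        (degree-away G S (P ∘ suc) bundle v v₁≢v))
        (add-bundle-edge (P 0) _ _ (count (removed G) (P ∘ suc))))
  degree-away ((a , b) ∷ G) S P bundle v v₁≢v | no v₁≢a | no v₁≢b = begin
    degIn ((a , b) ∷ G) (S fz ∷ᵛ extend G (S ∘ fs) P) v
      ≡⟨ degIn-cons (a , b) G _ v ⟩
    edge + degIn G (extend G (S ∘ fs) P) v
      ≡⟨ cong (edge +_) (degree-away G (S ∘ fs) P bundle v v₁≢v) ⟩
    edge + (rest + chosen)
      ≡⟨ sym (+-assoc edge rest chosen) ⟩
    edge + rest + chosen
      ≡⟨ cong (λ c → (if S fz then c else 0) + rest + chosen)
              (sym (incidence-punchOut v₁≢v v₁≢a v₁≢b)) ⟩
    (if S fz then incidence (punchOut v₁≢v) (punchOut v₁≢a , punchOut v₁≢b) else 0) + rest + chosen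
      ≡⟨ cong (_+ chosen) (sym (degIn-cons _ (deleteVertex G v₁) S (punchOut v₁≢v))) ⟩
    degIn ((punchOut v₁≢a , punchOut v₁≢b) ∷ deleteVertex G v₁) S (punchOut v₁≢v) + chosen
      ∎
    where
    open ≡-Reasoning
    edge = if S fz then incidence v (a , b) else 0
    rest = degIn (deleteVertex G v₁) (S ∘ fs) (punchOut v₁≢v)
    chosen = count (removed G) P * incidence v (v₁ , v₂)

  extend-cycle : ∀ G S P → BundleAt G → IsCycle (deleteVertex G v₁) S →
    2 ∣ count (removed G) P → IsCycle G (extend G S P)
  extend-cycle G S P bundle cycle even v with v₁ ≟ v
  ... | yes refl = subst (2 ∣_) (sym (degree-at-v₁ G S P bundle)) (∣m⇒∣m*n _ even)
  ... | no v₁≢v = subst (2 ∣_) (sym (degree-away G S P bundle v v₁≢v))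
                    (∣m∣n⇒∣m+n (cycle (punchOut v₁≢v)) (∣m⇒∣m*n _ even))

  module _ (v₁≢v₂ : v₁ ≢ v₂) where

    edge-joins : Fin (suc n) × Fin (suc n) → ℕ
    edge-joins x = ind (joins v₁ v₂ x)

    edge-joins≤incidence : ∀ a b → edge-joins (a , b) ≤ incidence v₁ (a , b)
    edge-joins≤incidence a b = joins≤incidence ⌊ a ≟ v₁ ⌋ ⌊ b ≟ v₁ ⌋ ⌊ a ≟ v₂ ⌋ ⌊ b ≟ v₂ ⌋

    multiplicity≤deg : ∀ G → multiplicity G v₁ v₂ ≤ deg G v₁
    multiplicity≤deg [] = z≤n
    multiplicity≤deg ((a , b) ∷ G)
      rewrite multiplicity-cons (a , b) G v₁ v₂ | deg-cons (a , b) G v₁ =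
      +-mono-≤ (edge-joins≤incidence a b) (multiplicity≤deg G)

    other-end-first : ∀ a b → v₁ ≡ a → incidence v₁ (a , b) ≡ edge-joins (a , b) → b ≡ v₂
    other-end-first a b v₁≡a tight = ≟-true (joins≡incidence-first _ _ _ _
      (≟-yes (sym v₁≡a)) (≟-no (v₁≢v₂ ∘ trans v₁≡a)) tight)

    other-end-second : ∀ a b → v₁ ≢ a → v₁ ≡ b → incidence v₁ (a , b) ≡ edge-joins (a , b) → a ≡ v₂
    other-end-second a b v₁≢a v₁≡b tight = ≟-true (joins≡incidence-second _ _ _ _
      (≟-no (v₁≢a ∘ sym)) (≟-yes (sym v₁≡b)) tight)

    -- deg v₁ = mult(v₁, v₂) forces equality edge by edge, so every edge at v₁ goes to v₂
    bundleAt : ∀ G → deg G v₁ ≡ multiplicity G v₁ v₂ → BundleAt G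
    bundleAt [] _ = tt
    bundleAt ((a , b) ∷ G) deg≡mult = at-edge (+-tight _ _ _ _
      (trans (sym (deg-cons (a , b) G v₁)) (trans deg≡mult (multiplicity-cons (a , b) G v₁ v₂)))
      (edge-joins≤incidence a b) (multiplicity≤deg G))
      where
      at-edge : incidence v₁ (a , b) ≡ edge-joins (a , b) × deg G v₁ ≡ multiplicity G v₁ v₂ →
        BundleAt ((a , b) ∷ G)
      at-edge (tight , rest) with v₁ ≟ a | v₁ ≟ b
      ... | yes v₁≡a | _ = other-end-first a b v₁≡a tight , bundleAt G rest
      ... | no v₁≢a | yes v₁≡b = other-end-second a b v₁≢a v₁≡b tight , bundleAt G rest
      ... | no _ | no _ = bundleAt G rest

    removed≡multiplicity : ∀ G → BundleAt G → removed G ≡ multiplicity G v₁ v₂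
    removed≡multiplicity [] _ = refl
    removed≡multiplicity ((a , b) ∷ G) bundle with v₁ ≟ a | v₁ ≟ b
    removed≡multiplicity ((a , b) ∷ G) (refl , bundle) | yes refl | _
      rewrite multiplicity-cons (v₁ , v₂) G v₁ v₂ | ≟-yes {x = v₁} refl | ≟-yes {x = v₂} refl =
      cong suc (removed≡multiplicity G bundle)
    removed≡multiplicity ((a , b) ∷ G) (refl , bundle) | no _ | yes refl
      rewrite multiplicity-cons (v₂ , v₁) G v₁ v₂ | ≟-yes {x = v₁} refl | ≟-yes {x = v₂} refl
            | ≟-no (v₁≢v₂ ∘ sym) =
      cong suc (removed≡multiplicity G bundle)
    removed≡multiplicity ((a , b) ∷ G) bundle | no v₁≢a | no v₁≢b
      rewrite multiplicity-cons (a , b) G v₁ v₂ | ≟-no (v₁≢a ∘ sym) | ≟-no (v₁≢b ∘ sym)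
            | ∧-zeroʳ ⌊ a ≟ v₂ ⌋ =
      removed≡multiplicity G bundle

  extend-cover : ∀ G → BundleAt G → (C′ : ThreeCycleCover (deleteVertex G v₁)) →
    (B : BundleCover (removed G)) →
    Σ (ThreeCycleCover G) (λ C → coverLength C ≡ coverLength C′ + bundleLength B)
  extend-cover G bundle C′ B = C , length-sum
    where
    open ThreeCycleCover C′
    open BundleCover B renaming (covers to coversBundle)
    C : ThreeCycleCover G
    C = record
      { C₁ = extend G C₁ P₁ ; C₂ = extend G C₂ P₂ ; C₃ = extend G C₃ P₃
      ; cyc₁ = extend-cycle G C₁ P₁ bundle cyc₁ even₁
      ; cyc₂ = extend-cycle G C₂ P₂ bundle cyc₂ even₂
      ; cyc₃ = extend-cycle G C₃ P₃ bundle cyc₃ even₃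
      ; covers = extend-covers G C₁ C₂ C₃ P₁ P₂ P₃ covers coversBundle }
    length-sum : coverLength C ≡ coverLength C′ + bundleLength B
    length-sum = trans
      (cong₂ _+_ (cong₂ _+_ (size-extend G C₁ P₁) (size-extend G C₂ P₂)) (size-extend G C₃ P₃))
      (+-interchange₃ (size G′ C₁) (size G′ C₂) (size G′ C₃)
                      (count (removed G) P₁) (count (removed G) P₂) (count (removed G) P₃))
      where
      G′ : Graph n
      G′ = deleteVertex G v₁

lemma18 : ∀ {n} (G : Graph (suc n)) (v₁ v₂ : Fin (suc n)) (k : ℕ)
    → Bridgeless G
    → 3 ≤ k
    → v₁ ≢ v₂
    → multiplicity G v₁ v₂ ≡ k
    → deg G v₁ ≡ k
    → k + 3 ≤ deg G v₂
    → Σ (ThreeCycleCover (deleteVertex G v₁)) (λ C → 27 * coverLength C ≤ 44 * (numEdges G ∸ k))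
    → Σ (ThreeCycleCover G) (λ C → 27 * coverLength C ≤ 44 * numEdges G)
lemma18 G v₁ v₂ k _ 3≤k v₁≢v₂ multiplicity≡k deg≡k _ (C′ , bound′) = C , bound
  where
  open BundleExtension v₁ v₂
  bundle : BundleAt G
  bundle = bundleAt v₁≢v₂ G (trans deg≡k (sym multiplicity≡k))
  removed≡k : removed G ≡ k
  removed≡k = trans (removed≡multiplicity v₁≢v₂ G bundle) multiplicity≡k
  2≤removed : 2 ≤ removed G
  2≤removed = subst (2 ≤_) (sym removed≡k) (≤-trans (n≤1+n 2) 3≤k)
  B : BundleCover (removed G)
  B = bundleCover (removed G) 2≤removed
  extended : Σ (ThreeCycleCover G) (λ C → coverLength C ≡ coverLength C′ + bundleLength B)
  extended = extend-cover G bundle C′ B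
  C : ThreeCycleCover G
  C = proj₁ extended
  bound : 27 * coverLength C ≤ 44 * numEdges G
  bound = subst (λ l → 27 * l ≤ 44 * numEdges G) (sym (proj₂ extended))
    (combine-bounds (coverLength C′) (bundleLength B) (numEdges G) (removed G)
      (subst (λ r → 27 * coverLength C′ ≤ 44 * (numEdges G ∸ r)) (sym removed≡k) bound′)
      (bundle-bound (removed G) (bundleLength B) 2≤removed (BundleCover.total≤ B))
      (subst (removed G ≤_) (sym (length-removed G)) (m≤n+m (removed G) _)))
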